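{- For integers $0\le k\le n$ let \[T(n,k)=\sum_{\substack{0\le j\le n-k\\ 2\mid j}}\binom{k}{j}\binom{n-k}{j}.\] Let $n$ and $k$ be nonnegative integers with $k\le n$. If $2\mid n+k$, then $T(n,k)\equiv\binom{n}{k}\pmod 2$. Otherwise, $T(n,k)\equiv\binom{n-1}{k}\pmod 2$. -}

module Defs where

open import Data.Nat using (ℕ; zero; suc; _+_; _∸_)
open import Data.Nat.Combinatorics using (_C_)
open import Data.Nat.Divisibility using (_∣?_)
open import Relation.Nullary.Decidable using (does)
open import Data.Bool using (if_then_else_)

ΣEven : ℕ → (ℕ → ℕ) → ℕ
ΣEven zero    f = f 0
ΣEven (suc m) f = ΣEven m f + (if does (2 ∣? suc m) then f (suc m) else 0)

T : ℕ → ℕ → ℕ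
T n k = ΣEven (n ∸ k) (λ j → (k C j) Data.Nat.* ((n ∸ k) C j))

-- Write n = m + k. Modulo 2, Lucas's theorem gives C(k,2i)·C(m,2i) ≡ C(⌊k/2⌋,i)·C(⌊m/2⌋,i),
-- so by Vandermonde's identity T(n,k) ≡ Σᵢ C(⌊k/2⌋,i)·C(⌊m/2⌋,i) = C(⌊k/2⌋+⌊m/2⌋,⌊k/2⌋).
-- Lucas's theorem once more identifies this with C(n,k) when m is even and with
-- C(n−1,k) when m is odd, and m ≡ n + k (mod 2).
module Submission where

open import Defs
open import Data.Nat using (ℕ; zero; suc; _+_; _*_; _∸_; _≤_; _%_; ⌊_/2⌋; parity)
open import Data.Nat.Properties
  using (+-identityʳ; +-assoc; +-comm; *-distribʳ-+; +-commutativeSemigroup; m+n∸n≡m; m∸n+n≡m; m≤n+m; ≤-refl; m≤n⇒m≤1+n)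
open import Algebra.Properties.CommutativeSemigroup +-commutativeSemigroup
  using (interchange; x∙yz≈y∙xz)
open import Data.Nat.Combinatorics using (_C_; nCk+nC[k+1]≡[n+1]C[k+1]; nCk≡nC[n∸k]; nC1≡n)
open import Data.Nat.Divisibility using (_∣_; _∣?_; divides; ∣m∣n⇒∣m+n; ∣-refl)
open import Data.Parity.Base as ℙ using (Parity; 0ℙ; 1ℙ)
open import Data.Parity.Properties as ℙₚ using (+-homo-+; *-homo-*)
open import Data.Product using (_×_; _,_)
open import Relation.Nullary using (¬_; contradiction)
open import Relation.Nullary.Decidable using (dec-true; dec-false)
open import Relation.Binary.PropositionalEquality
open ≡-Reasoning

double : ℕ → ℕ
double zero    = zero
double (suc h) = suc (suc (double h))

data Halving : ℕ → Set where
  even : ∀ h → Halving (double h)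
  odd  : ∀ h → Halving (suc (double h))

halving : ∀ m → Halving m
halving zero = even zero
halving (suc m) with halving m
... | even h = odd h
... | odd h  = even (suc h)

parity-double : ∀ h → parity (double h) ≡ 0ℙ
parity-double zero    = refl
parity-double (suc h) = parity-double h

parity-suc-double : ∀ h → parity (suc (double h)) ≡ 1ℙ
parity-suc-double zero    = refl
parity-suc-double (suc h) = parity-suc-double h

parity-double+ : ∀ h k → parity (double h + k) ≡ parity k
parity-double+ zero    k = refl
parity-double+ (suc h) k = parity-double+ h k

⌊double/2⌋ : ∀ h → ⌊ double h /2⌋ ≡ h
⌊double/2⌋ zero    = refl
⌊double/2⌋ (suc h) = cong suc (⌊double/2⌋ h)

⌊suc-double/2⌋ : ∀ h → ⌊ suc (double h) /2⌋ ≡ h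
⌊suc-double/2⌋ zero    = refl
⌊suc-double/2⌋ (suc h) = cong suc (⌊suc-double/2⌋ h)

⌊double+/2⌋ : ∀ h k → ⌊ double h + k /2⌋ ≡ h + ⌊ k /2⌋
⌊double+/2⌋ zero    k = refl
⌊double+/2⌋ (suc h) k = cong suc (⌊double+/2⌋ h k)

parity≡0ℙ⇒2∣ : ∀ n → parity n ≡ 0ℙ → 2 ∣ n
parity≡0ℙ⇒2∣ zero          _ = divides 0 refl
parity≡0ℙ⇒2∣ (suc (suc n)) e = ∣m∣n⇒∣m+n ∣-refl (parity≡0ℙ⇒2∣ n e)

2∣⇒parity≡0ℙ : ∀ {n} → 2 ∣ n → parity n ≡ 0ℙ
2∣⇒parity≡0ℙ (divides q refl) = trans (*-homo-* q 2) (ℙₚ.*-zeroʳ (parity q))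

2∣double : ∀ h → 2 ∣ double h
2∣double h = parity≡0ℙ⇒2∣ (double h) (parity-double h)

¬2∣suc-double : ∀ h → ¬ 2 ∣ suc (double h)
¬2∣suc-double h d with () ← trans (sym (2∣⇒parity≡0ℙ d)) (parity-suc-double h)

parity-m+k+k : ∀ m k → parity ((m + k) + k) ≡ parity m
parity-m+k+k m k = begin
  parity ((m + k) + k)             ≡⟨ cong parity (+-assoc m k k) ⟩
  parity (m + (k + k))             ≡⟨ +-homo-+ m (k + k) ⟩
  parity m ℙ.+ parity (k + k)      ≡⟨ cong (parity m ℙ.+_) (trans (+-homo-+ k k) (ℙₚ.p+p≡0ℙ (parity k))) ⟩
  parity m ℙ.+ 0ℙ                  ≡⟨ ℙₚ.+-identityʳ (parity m) ⟩
  parity m                         ∎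

2∣m⇒2∣[m+k]+k : ∀ m k → 2 ∣ m → 2 ∣ (m + k) + k
2∣m⇒2∣[m+k]+k m k d = parity≡0ℙ⇒2∣ ((m + k) + k) (trans (parity-m+k+k m k) (2∣⇒parity≡0ℙ d))

2∣[m+k]+k⇒2∣m : ∀ m k → 2 ∣ (m + k) + k → 2 ∣ m
2∣[m+k]+k⇒2∣m m k d = parity≡0ℙ⇒2∣ m (trans (sym (parity-m+k+k m k)) (2∣⇒parity≡0ℙ d))

parity≡⇒%2≡ : ∀ m n → parity m ≡ parity n → m % 2 ≡ n % 2
parity≡⇒%2≡ zero          zero          _ = refl
parity≡⇒%2≡ (suc zero)    (suc zero)    _ = refl
parity≡⇒%2≡ (suc (suc m)) n             e = parity≡⇒%2≡ m n e
parity≡⇒%2≡ m             (suc (suc n)) e = parity≡⇒%2≡ m n e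

pascal : ∀ n k → suc n C suc k ≡ n C k + n C suc k
pascal n k = sym (nCk+nC[k+1]≡[n+1]C[k+1] n k)

-- The binomial coefficient of two binary digits: the last-digit factor in Lucas's theorem.
_Cℙ_ : Parity → Parity → Parity
p Cℙ 0ℙ = 1ℙ
p Cℙ 1ℙ = p

Cℙ-refl : ∀ p → p Cℙ p ≡ 1ℙ
Cℙ-refl 0ℙ = refl
Cℙ-refl 1ℙ = refl

+-cancel-middle : ∀ a b c → (a ℙ.+ b) ℙ.+ (b ℙ.+ c) ≡ a ℙ.+ c
+-cancel-middle 0ℙ 0ℙ c  = refl
+-cancel-middle 0ℙ 1ℙ 0ℙ = refl
+-cancel-middle 0ℙ 1ℙ 1ℙ = refl
+-cancel-middle 1ℙ 0ℙ c  = refl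
+-cancel-middle 1ℙ 1ℙ 0ℙ = refl
+-cancel-middle 1ℙ 1ℙ 1ℙ = refl

-- (1 + x)² ≡ 1 + x² (mod 2), read coefficientwise.
C-frobenius : ∀ n ℓ → parity (suc (suc n) C suc (suc ℓ)) ≡ parity (n C ℓ) ℙ.+ parity (n C suc (suc ℓ))
C-frobenius n ℓ = begin
  parity (suc (suc n) C suc (suc ℓ))
    ≡⟨ cong parity (trans (pascal (suc n) (suc ℓ)) (cong₂ _+_ (pascal n ℓ) (pascal n (suc ℓ)))) ⟩
  parity ((a + b) + (b + c))
    ≡⟨ trans (+-homo-+ (a + b) (b + c)) (cong₂ ℙ._+_ (+-homo-+ a b) (+-homo-+ b c)) ⟩
  (parity a ℙ.+ parity b) ℙ.+ (parity b ℙ.+ parity c)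
    ≡⟨ +-cancel-middle (parity a) (parity b) (parity c) ⟩
  parity a ℙ.+ parity c
    ∎
  where
  a = n C ℓ
  b = n C suc ℓ
  c = n C suc (suc ℓ)

lucas₂ : ∀ n ℓ → parity (n C ℓ) ≡ parity (⌊ n /2⌋ C ⌊ ℓ /2⌋) ℙ.* (parity n Cℙ parity ℓ)
lucas₂ n             zero          = refl
lucas₂ n             (suc zero)    = cong parity (nC1≡n n)
lucas₂ zero          (suc (suc ℓ)) = refl
lucas₂ (suc zero)    (suc (suc ℓ)) = refl
lucas₂ (suc (suc n)) (suc (suc ℓ)) = begin
  parity (suc (suc n) C suc (suc ℓ))                              ≡⟨ C-frobenius n ℓ ⟩
  parity (n C ℓ) ℙ.+ parity (n C suc (suc ℓ))                     ≡⟨ cong₂ ℙ._+_ (lucas₂ n ℓ) (lucas₂ n (suc (suc ℓ))) ⟩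
  (parity (h C l) ℙ.* b) ℙ.+ (parity (h C suc l) ℙ.* b)          ≡⟨ ℙₚ.*-distribʳ-+ b (parity (h C l)) (parity (h C suc l)) ⟨
  (parity (h C l) ℙ.+ parity (h C suc l)) ℙ.* b                  ≡⟨ cong (ℙ._* b) (+-homo-+ (h C l) (h C suc l)) ⟨
  parity (h C l + h C suc l) ℙ.* b                               ≡⟨ cong (λ x → parity x ℙ.* b) (pascal h l) ⟨
  parity (suc h C suc l) ℙ.* b                                   ∎
  where
  h = ⌊ n /2⌋
  l = ⌊ ℓ /2⌋
  b = parity n Cℙ parity ℓ

parity-C-double : ∀ n i → parity (n C double i) ≡ parity (⌊ n /2⌋ C i)
parity-C-double n i = begin
  parity (n C double i)
    ≡⟨ lucas₂ n (double i) ⟩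
  parity (⌊ n /2⌋ C ⌊ double i /2⌋) ℙ.* (parity n Cℙ parity (double i))
    ≡⟨ cong₂ (λ j p → parity (⌊ n /2⌋ C j) ℙ.* (parity n Cℙ p)) (⌊double/2⌋ i) (parity-double i) ⟩
  parity (⌊ n /2⌋ C i) ℙ.* 1ℙ
    ≡⟨ ℙₚ.*-identityʳ _ ⟩
  parity (⌊ n /2⌋ C i)
    ∎

parity-C-same-parity : ∀ {n ℓ} → parity n ≡ parity ℓ → parity (n C ℓ) ≡ parity (⌊ n /2⌋ C ⌊ ℓ /2⌋)
parity-C-same-parity {n} {ℓ} e = begin
  parity (n C ℓ)
    ≡⟨ lucas₂ n ℓ ⟩
  parity (⌊ n /2⌋ C ⌊ ℓ /2⌋) ℙ.* (parity n Cℙ parity ℓ)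
    ≡⟨ cong (parity (⌊ n /2⌋ C ⌊ ℓ /2⌋) ℙ.*_) (trans (cong (_Cℙ parity ℓ) e) (Cℙ-refl (parity ℓ))) ⟩
  parity (⌊ n /2⌋ C ⌊ ℓ /2⌋) ℙ.* 1ℙ
    ≡⟨ ℙₚ.*-identityʳ _ ⟩
  parity (⌊ n /2⌋ C ⌊ ℓ /2⌋)
    ∎

ΣUpTo : ℕ → (ℕ → ℕ) → ℕ
ΣUpTo zero    f = f 0
ΣUpTo (suc m) f = ΣUpTo m f + f (suc m)

ΣUpTo-cong : ∀ m {f g : ℕ → ℕ} → (∀ {i} → i ≤ m → f i ≡ g i) → ΣUpTo m f ≡ ΣUpTo m g
ΣUpTo-cong zero    e = e ≤-refl
ΣUpTo-cong (suc m) e = cong₂ _+_ (ΣUpTo-cong m (λ i≤m → e (m≤n⇒m≤1+n i≤m))) (e ≤-refl)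

ΣUpTo-parity-cong : ∀ m {f g : ℕ → ℕ} → (∀ i → parity (f i) ≡ parity (g i)) →
                    parity (ΣUpTo m f) ≡ parity (ΣUpTo m g)
ΣUpTo-parity-cong zero    e = e 0
ΣUpTo-parity-cong (suc m) {f} {g} e = begin
  parity (ΣUpTo m f + f (suc m))              ≡⟨ +-homo-+ (ΣUpTo m f) (f (suc m)) ⟩
  parity (ΣUpTo m f) ℙ.+ parity (f (suc m))   ≡⟨ cong₂ ℙ._+_ (ΣUpTo-parity-cong m e) (e (suc m)) ⟩
  parity (ΣUpTo m g) ℙ.+ parity (g (suc m))   ≡⟨ +-homo-+ (ΣUpTo m g) (g (suc m)) ⟨
  parity (ΣUpTo m g + g (suc m))              ∎

ΣUpTo-+ : ∀ m (f g : ℕ → ℕ) → ΣUpTo m (λ i → f i + g i) ≡ ΣUpTo m f + ΣUpTo m g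
ΣUpTo-+ zero    f g = refl
ΣUpTo-+ (suc m) f g = trans (cong (_+ (f (suc m) + g (suc m))) (ΣUpTo-+ m f g))
                            (interchange (ΣUpTo m f) (ΣUpTo m g) (f (suc m)) (g (suc m)))

ΣUpTo-suc : ∀ m (f : ℕ → ℕ) → ΣUpTo (suc m) f ≡ f 0 + ΣUpTo m (λ i → f (suc i))
ΣUpTo-suc zero    f = refl
ΣUpTo-suc (suc m) f = trans (cong (_+ f (suc (suc m))) (ΣUpTo-suc m f))
                            (+-assoc (f 0) (ΣUpTo m (λ i → f (suc i))) (f (suc (suc m))))

ΣUpTo-vanishing-tail : ∀ m (f : ℕ → ℕ) → (∀ i → f (suc i) ≡ 0) → ΣUpTo m f ≡ f 0
ΣUpTo-vanishing-tail zero    f e = refl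
ΣUpTo-vanishing-tail (suc m) f e = trans (cong₂ _+_ (ΣUpTo-vanishing-tail m f e) (e m)) (+-identityʳ (f 0))

vandermonde : ∀ a b c → ΣUpTo c (λ i → (a C i) * (b C (c ∸ i))) ≡ (a + b) C c
vandermonde zero    b c       = trans (ΣUpTo-vanishing-tail c _ (λ _ → refl)) (+-identityʳ (b C c))
vandermonde (suc a) b zero    = refl
vandermonde (suc a) b (suc c) = begin
  ΣUpTo (suc c) (λ i → (suc a C i) * (b C (suc c ∸ i)))
    ≡⟨ ΣUpTo-suc c _ ⟩
  x + ΣUpTo c (λ i → (suc a C suc i) * (b C (c ∸ i)))
    ≡⟨ cong (x +_) (ΣUpTo-cong c (λ {i} _ → trans (cong (_* (b C (c ∸ i))) (pascal a i))
                                               (*-distribʳ-+ (b C (c ∸ i)) (a C i) (a C suc i)))) ⟩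
  x + ΣUpTo c (λ i → (a C i) * (b C (c ∸ i)) + (a C suc i) * (b C (c ∸ i)))
    ≡⟨ cong (x +_) (ΣUpTo-+ c _ _) ⟩
  x + (S₀ + S₁)
    ≡⟨ x∙yz≈y∙xz x S₀ S₁ ⟩
  S₀ + (x + S₁)
    ≡⟨ cong₂ _+_ (vandermonde a b c) (trans (sym (ΣUpTo-suc c (λ i → (a C i) * (b C (suc c ∸ i)))))
                                           (vandermonde a b (suc c))) ⟩
  (a + b) C c + (a + b) C suc c
    ≡⟨ pascal (a + b) c ⟨
  suc (a + b) C suc c
    ∎
  where
  x  = 1 * (b C suc c)
  S₀ = ΣUpTo c (λ i → (a C i) * (b C (c ∸ i)))
  S₁ = ΣUpTo c (λ i → (a C suc i) * (b C (c ∸ i)))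

vandermonde-diagonal : ∀ a b → ΣUpTo b (λ i → (a C i) * (b C i)) ≡ (a + b) C a
vandermonde-diagonal a b = begin
  ΣUpTo b (λ i → (a C i) * (b C i))          ≡⟨ ΣUpTo-cong b (λ {i} i≤b → cong ((a C i) *_) (nCk≡nC[n∸k] i≤b)) ⟩
  ΣUpTo b (λ i → (a C i) * (b C (b ∸ i)))    ≡⟨ vandermonde a b b ⟩
  (a + b) C b                                 ≡⟨ nCk≡nC[n∸k] (m≤n+m b a) ⟩
  (a + b) C ((a + b) ∸ b)                     ≡⟨ cong ((a + b) C_) (m+n∸n≡m a b) ⟩
  (a + b) C a                                 ∎

ΣEven-suc-even : ∀ m f → 2 ∣ suc m → ΣEven (suc m) f ≡ ΣEven m f + f (suc m)
ΣEven-suc-even m f d rewrite dec-true (2 ∣? suc m) d = refl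

ΣEven-suc-odd : ∀ m f → ¬ 2 ∣ suc m → ΣEven (suc m) f ≡ ΣEven m f
ΣEven-suc-odd m f d rewrite dec-false (2 ∣? suc m) d = +-identityʳ (ΣEven m f)

ΣEven-double : ∀ h f → ΣEven (double h) f ≡ ΣUpTo h (λ i → f (double i))
ΣEven-double zero    f = refl
ΣEven-double (suc h) f = begin
  ΣEven (suc (suc (double h))) f                 ≡⟨ ΣEven-suc-even _ f (2∣double (suc h)) ⟩
  ΣEven (suc (double h)) f + f (double (suc h))  ≡⟨ cong (_+ f (double (suc h))) (ΣEven-suc-odd _ f (¬2∣suc-double h)) ⟩
  ΣEven (double h) f + f (double (suc h))        ≡⟨ cong (_+ f (double (suc h))) (ΣEven-double h f) ⟩
  ΣUpTo (suc h) (λ i → f (double i))             ∎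

ΣEven-halving : ∀ m f → ΣEven m f ≡ ΣUpTo ⌊ m /2⌋ (λ i → f (double i))
ΣEven-halving m f with halving m
... | even h rewrite ⌊double/2⌋ h     = ΣEven-double h f
... | odd h  rewrite ⌊suc-double/2⌋ h = trans (ΣEven-suc-odd _ f (¬2∣suc-double h)) (ΣEven-double h f)

T-as-ΣEven : ∀ m k → T (m + k) k ≡ ΣEven m (λ j → (k C j) * (m C j))
T-as-ΣEven m k = cong (λ r → ΣEven r (λ j → (k C j) * (r C j))) (m+n∸n≡m m k)

parity-T : ∀ m k → parity (T (m + k) k) ≡ parity ((⌊ k /2⌋ + ⌊ m /2⌋) C ⌊ k /2⌋)
parity-T m k = begin
  parity (T (m + k) k)
    ≡⟨ cong parity (trans (T-as-ΣEven m k) (ΣEven-halving m _)) ⟩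
  parity (ΣUpTo ⌊ m /2⌋ (λ i → (k C double i) * (m C double i)))
    ≡⟨ ΣUpTo-parity-cong ⌊ m /2⌋ halve-summand ⟩
  parity (ΣUpTo ⌊ m /2⌋ (λ i → (⌊ k /2⌋ C i) * (⌊ m /2⌋ C i)))
    ≡⟨ cong parity (vandermonde-diagonal ⌊ k /2⌋ ⌊ m /2⌋) ⟩
  parity ((⌊ k /2⌋ + ⌊ m /2⌋) C ⌊ k /2⌋)
    ∎
  where
  halve-summand : ∀ i → parity ((k C double i) * (m C double i)) ≡ parity ((⌊ k /2⌋ C i) * (⌊ m /2⌋ C i))
  halve-summand i = begin
    parity ((k C double i) * (m C double i))               ≡⟨ *-homo-* (k C double i) (m C double i) ⟩
    parity (k C double i) ℙ.* parity (m C double i)        ≡⟨ cong₂ ℙ._*_ (parity-C-double k i) (parity-C-double m i) ⟩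
    parity (⌊ k /2⌋ C i) ℙ.* parity (⌊ m /2⌋ C i)          ≡⟨ *-homo-* (⌊ k /2⌋ C i) (⌊ m /2⌋ C i) ⟨
    parity ((⌊ k /2⌋ C i) * (⌊ m /2⌋ C i))                 ∎

parity-C-double+ : ∀ h k → parity ((double h + k) C k) ≡ parity ((⌊ k /2⌋ + h) C ⌊ k /2⌋)
parity-C-double+ h k = trans (parity-C-same-parity {double h + k} {k} (parity-double+ h k))
                             (cong (λ t → parity (t C ⌊ k /2⌋)) (trans (⌊double+/2⌋ h k) (+-comm h ⌊ k /2⌋)))

parity-T-double : ∀ h k → parity (T (double h + k) k) ≡ parity ((double h + k) C k)
parity-T-double h k = begin
  parity (T (double h + k) k)                          ≡⟨ parity-T (double h) k ⟩
  parity ((⌊ k /2⌋ + ⌊ double h /2⌋) C ⌊ k /2⌋)       ≡⟨ cong (λ t → parity ((⌊ k /2⌋ + t) C ⌊ k /2⌋)) (⌊double/2⌋ h) ⟩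
  parity ((⌊ k /2⌋ + h) C ⌊ k /2⌋)                    ≡⟨ parity-C-double+ h k ⟨
  parity ((double h + k) C k)                          ∎

parity-T-suc-double : ∀ h k → parity (T (suc (double h) + k) k) ≡ parity ((double h + k) C k)
parity-T-suc-double h k = begin
  parity (T (suc (double h) + k) k)                     ≡⟨ parity-T (suc (double h)) k ⟩
  parity ((⌊ k /2⌋ + ⌊ suc (double h) /2⌋) C ⌊ k /2⌋)  ≡⟨ cong (λ t → parity ((⌊ k /2⌋ + t) C ⌊ k /2⌋)) (⌊suc-double/2⌋ h) ⟩
  parity ((⌊ k /2⌋ + h) C ⌊ k /2⌋)                     ≡⟨ parity-C-double+ h k ⟨
  parity ((double h + k) C k)                           ∎

Proposition2 : ℕ → ℕ → Set
Proposition2 n k = ((2 ∣ n + k) → T n k % 2 ≡ (n C k) % 2) ×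
                   (¬ (2 ∣ n + k) → T n k % 2 ≡ ((n ∸ 1) C k) % 2)

proposition2-shifted : ∀ m k → Proposition2 (m + k) k
proposition2-shifted m k with halving m
... | even h = (λ _ → parity≡⇒%2≡ (T (double h + k) k) ((double h + k) C k) (parity-T-double h k))
             , (λ 2∤ → contradiction (2∣m⇒2∣[m+k]+k (double h) k (2∣double h)) 2∤)
... | odd h  = (λ 2∣ → contradiction (2∣[m+k]+k⇒2∣m (suc (double h)) k 2∣) (¬2∣suc-double h))
             , (λ _ → parity≡⇒%2≡ (T (suc (double h) + k) k) ((double h + k) C k) (parity-T-suc-double h k))

proposition2 : (n k : ℕ) → k ≤ n →
    ((2 ∣ n + k) → T n k % 2 ≡ (n C k) % 2) ×
    (¬ (2 ∣ n + k) → T n k % 2 ≡ ((n ∸ 1) C k) % 2)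
proposition2 n k k≤n = subst (λ n → Proposition2 n k) (m∸n+n≡m k≤n) (proposition2-shifted (n ∸ k) k)
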